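{- Let $G$ be a graph, let $Q$ be a clique of $G$ with $q\ge 1$ vertices, and let $G'$ be the graph obtained from $G$ by adding a new vertex $v$ adjacent to exactly the vertices of $Q$. Then: (1) if $G$ has an acyclic orientation $D$ with $d(D)=d$, then $G'$ has an acyclic orientation $D'$ with $d(D')=d+q-1$; (2) $d_{\min}(G')$ equals either $d_{\min}(G)+q-2$ or $d_{\min}(G)+q-1$.
   Context: All graphs are finite, without loops or multiple edges. A clique is a set of pairwise adjacent vertices (a complete subgraph). An orientation of $G$ assigns a direction to each edge; it is acyclic if it contains no directed cycle. In an acyclic orientation $D$, an arc is called dependent if reversing it creates a directed cycle. $d(D)$ is the number of dependent arcs of $D$; $d_{\min}(G)$ is the minimum of $d(D)$ over all acyclic orientations $D$ of $G$. -}

module Defs where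

open import Data.Nat using (ℕ; zero; suc; _+_; _∸_; _≤_)
open import Data.Fin using (Fin; zero; suc; _≟_)
open import Data.Fin.Subset using (Subset; _∈_; ∣_∣)
open import Data.Vec using (lookup)
open import Data.Bool using (Bool; true; false; if_then_else_; _∧_)
open import Data.List using (List; length)
open import Data.List.Relation.Unary.Unique.Propositional using (Unique)
import Data.List.Membership.Propositional as LM
open import Data.Product using (Σ; _×_; _,_; ∃)
open import Data.Sum using (_⊎_)
open import Relation.Nullary using (¬_; does)
open import Relation.Binary.PropositionalEquality using (_≡_; _≢_; refl)
open import Function.Bundles using (_⇔_)

record Graph (n : ℕ) : Set where
  field
    Adj    : Fin n → Fin n → Bool
    sym    : ∀ i j → Adj i j ≡ Adj j i
    irrefl : ∀ i → Adj i i ≡ false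
open Graph public

record Orientation {n : ℕ} (G : Graph n) : Set where
  field
    Arc      : Fin n → Fin n → Bool
    onEdges  : ∀ i j → Arc i j ≡ true → Adj G i j ≡ true
    covers   : ∀ i j → Adj G i j ≡ true → Arc i j ≡ true ⊎ Arc j i ≡ true
    oneWay   : ∀ i j → Arc i j ≡ true → Arc j i ≡ false
open Orientation public

data Walk {n : ℕ} (A : Fin n → Fin n → Bool) : Fin n → Fin n → Set where
  arc  : ∀ {u v} → A u v ≡ true → Walk A u v
  _∷_  : ∀ {u w v} → A u w ≡ true → Walk A w v → Walk A u v

HasCycle : {n : ℕ} → (Fin n → Fin n → Bool) → Set
HasCycle {n} A = Σ (Fin n) λ u → Walk A u u

Acyclic : {n : ℕ} {G : Graph n} → Orientation G → Set
Acyclic D = ¬ HasCycle (Arc D)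

_==_ : {n : ℕ} → Fin n → Fin n → Bool
x == y = does (x ≟ y)

reverseArc : {n : ℕ} → (Fin n → Fin n → Bool) → Fin n → Fin n → (Fin n → Fin n → Bool)
reverseArc A u v x y =
  if (x == v) ∧ (y == u) then true
  else (if (x == u) ∧ (y == v) then false else A x y)

Dependent : {n : ℕ} {G : Graph n} → Orientation G → Fin n → Fin n → Set
Dependent D u v = (Arc D u v ≡ true) × HasCycle (reverseArc (Arc D) u v)

HasDepCount : {n : ℕ} {G : Graph n} → Orientation G → ℕ → Set
HasDepCount {n} D k =
  Σ (List (Fin n × Fin n)) λ L →
    Unique L × length L ≡ k ×
    (∀ u v → (LM._∈_ (u , v) L) ⇔ Dependent D u v)

IsDmin : {n : ℕ} → Graph n → ℕ → Set
IsDmin G m =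
  (Σ (Orientation G) λ D → Acyclic D × HasDepCount D m) ×
  (∀ (D : Orientation G) k → Acyclic D → HasDepCount D k → m ≤ k)

IsClique : {n : ℕ} → Graph n → Subset n → Set
IsClique G Q = ∀ i j → i ∈ Q → j ∈ Q → i ≢ j → Adj G i j ≡ true

-- G' : add a new vertex (index zero) adjacent exactly to the vertices of Q;
-- old vertex i becomes suc i.
extAdj : {n : ℕ} → Graph n → Subset n → Fin (suc n) → Fin (suc n) → Bool
extAdj G Q zero zero = false
extAdj G Q zero (suc j) = lookup Q j
extAdj G Q (suc i) zero = lookup Q i
extAdj G Q (suc i) (suc j) = Adj G i j

extSym : {n : ℕ} (G : Graph n) (Q : Subset n) → ∀ i j → extAdj G Q i j ≡ extAdj G Q j i
extSym G Q zero zero = refl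
extSym G Q zero (suc j) = refl
extSym G Q (suc i) zero = refl
extSym G Q (suc i) (suc j) = sym G i j

extIrr : {n : ℕ} (G : Graph n) (Q : Subset n) → ∀ i → extAdj G Q i i ≡ false
extIrr G Q zero = refl
extIrr G Q (suc i) = irrefl G i

addVertex : {n : ℕ} → Graph n → Subset n → Graph (suc n)
addVertex G Q = record { Adj = extAdj G Q ; sym = extSym G Q ; irrefl = extIrr G Q }

module Submission where

-- Given an acyclic orientation D of G, let s be the source of D on the clique Q and orient every
-- new edge away from v. Old arcs keep their status, since no cycle passes through the source v;
-- v → w is dependent for w ≠ s because of v → s → w; and v → s is not, since a cycle through the
-- reversed arc would give a path c ⇝ s in D from some c ≠ s in Q, closed by s → c. So d grows by
-- exactly q − 1. Conversely, restricting an acyclic orientation of G′ to G loses no dependent arc,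
-- and at most two of the q arcs between v and Q are independent: among any three, two point the
-- same way and form a transitive triangle with the edge joining their ends, whose long side is
-- dependent.

open import Defs hiding (sym)
open import Data.Nat using (ℕ; suc; _+_; _∸_; _≤_)
open import Data.Fin.Subset using (Subset; ∣_∣)
open import Data.Product using (Σ; _×_)
open import Data.Sum using (_⊎_)
open import Relation.Binary.PropositionalEquality using (_≡_)

open import Data.Bool using (Bool; true; false; _∧_; if_then_else_)
open import Data.Bool.Properties using (¬-not) renaming (_≟_ to _≟ᵇ_)
open import Data.Empty using (⊥-elim)
open import Data.Fin as Fin using (Fin; zero; suc; toℕ; punchIn; punchOut)
open import Data.Fin.Properties using (any?; all?; pigeonhole; punchIn-punchOut; suc-injective)
open import Data.List using (List; []; _∷_; length; filter; map; _++_; cartesianProduct; allFin)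
import Data.List.Membership.DecPropositional as DecMembership
open import Data.List.Membership.Propositional using (_∈_)
open import Data.List.Membership.Propositional.Properties
  using (∈-filter⁺; ∈-filter⁻; ∈-cartesianProduct⁺; ∈-allFin; ∈-map⁺; ∈-map⁻; ∈-++⁺ˡ; ∈-++⁺ʳ; ∈-++⁻)
open import Data.List.Properties using (length-filter; length-map; length-++; filter-all)
open import Data.List.Relation.Binary.Subset.Propositional using (_⊆_)
open import Data.List.Relation.Unary.All as All using (All; _∷_)
open import Data.List.Relation.Unary.AllPairs using ([]; _∷_)
open import Data.List.Relation.Unary.Any using (here; there)
open import Data.List.Relation.Unary.Unique.Propositional using (Unique)
import Data.List.Relation.Unary.Unique.Propositional.Properties as Unique
open import Data.Nat using (zero; _<_; s≤s; s≤s⁻¹; z≤n)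
import Data.Nat.Properties as ℕ
open import Data.Product using (_,_; ∃₂; proj₁; proj₂; uncurry)
import Data.Product as Product
open import Data.Product.Properties using (≡-dec)
open import Data.Sum using (inj₁; inj₂; [_,_]′)
import Data.Sum as Sum
open import Data.Unit using (⊤; tt)
open import Data.Vec using ([]; _∷_; lookup)
open import Data.Vec.Properties using (lookup⇒[]=)
open import Function using (flip; _$_)
open import Function.Bundles using (_⇔_; mk⇔; Equivalence)
open Equivalence using (to; from)
open import Relation.Binary.Construct.Closure.ReflexiveTransitive as Star using (Star; ε; _◅_)
open import Relation.Binary.Definitions using (DecidableEquality)
open import Relation.Binary.PropositionalEquality
  using (_≢_; refl; sym; trans; cong; cong₂; subst; subst₂; module ≡-Reasoning)
open import Relation.Nullary using (¬_; Dec; yes; no; contradiction)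
open import Relation.Nullary.Decidable using (map′; _×-dec_; _→-dec_; ¬?)
open import Relation.Unary using (Decidable)

==-refl : ∀ {n} (x : Fin n) → (x == x) ≡ true
==-refl zero = refl
==-refl (suc x) = ==-refl x

==-pair-false : ∀ {n} {x y a b : Fin n} → (x , y) ≢ (a , b) → ((x == a) ∧ (y == b)) ≡ false
==-pair-false {x = x} {y} {a} {b} ne with x Fin.≟ a
... | no _ = refl
... | yes refl with y Fin.≟ b
...   | no _ = refl
...   | yes refl = contradiction refl ne

module _ {n} (A : Fin n → Fin n → Bool) (u v : Fin n) where

  reverseArc-new : reverseArc A u v v u ≡ true
  reverseArc-new rewrite ==-refl v | ==-refl u = refl

  reverseArc-other : ∀ {x y} → (x , y) ≢ (v , u) → (x , y) ≢ (u , v) → reverseArc A u v x y ≡ A x y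
  reverseArc-other ne₁ ne₂ rewrite ==-pair-false ne₁ | ==-pair-false ne₂ = refl

Arcs : ∀ {n} → (Fin n → Fin n → Bool) → Fin n → Fin n → Set
Arcs A x y = A x y ≡ true

module _ {n} {A : Fin n → Fin n → Bool} where

  _∷ʳ_ : ∀ {u w v} → Walk A u w → A w v ≡ true → Walk A u v
  arc p ∷ʳ q = p ∷ arc q
  (p ∷ w) ∷ʳ q = p ∷ (w ∷ʳ q)

  _++ʷ_ : ∀ {u w v} → Walk A u w → Walk A w v → Walk A u v
  arc p ++ʷ w′ = p ∷ w′
  (p ∷ w) ++ʷ w′ = p ∷ (w ++ʷ w′)

  _◅ʷ_ : ∀ {u w v} → A u w ≡ true → Star (Arcs A) w v → Walk A u v
  p ◅ʷ ε = arc p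
  p ◅ʷ (q ◅ s) = p ∷ (q ◅ʷ s)

  reverseʷ : ∀ {u v} → Walk (flip A) u v → Walk A v u
  reverseʷ (arc p) = arc p
  reverseʷ (p ∷ w) = reverseʷ w ∷ʳ p

mapʷ : ∀ {n m} {A : Fin n → Fin n → Bool} {B : Fin m → Fin m → Bool} (f : Fin n → Fin m) →
       (∀ {x y} → A x y ≡ true → B (f x) (f y) ≡ true) → ∀ {u v} → Walk A u v → Walk B (f u) (f v)
mapʷ f h (arc p) = arc (h p)
mapʷ f h (p ∷ w) = h p ∷ mapʷ f h w

-- Following successors forever inside a finite set must revisit a vertex.
module _ {n} {A : Fin n → Fin n → Bool} (P : Fin n → Set)
         (next : ∀ {x} → P x → Σ (Fin n) λ y → P y × A x y ≡ true) where

  private module Orbit {x} (px : P x) where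
    orbit : ℕ → Σ (Fin n) P
    orbit zero = x , px
    orbit (suc i) = let (y , py , _) = next (proj₂ (orbit i)) in y , py

    vertex : ℕ → Fin n
    vertex i = proj₁ (orbit i)

    walk : ∀ {i j} → i < j → Walk A (vertex i) (vertex j)
    walk {i} {suc j} i<1+j with ℕ.m<1+n⇒m<n∨m≡n i<1+j
    ... | inj₁ i<j = walk i<j ∷ʳ proj₂ (proj₂ (next (proj₂ (orbit j))))
    ... | inj₂ refl = arc (proj₂ (proj₂ (next (proj₂ (orbit i)))))

    cycle : HasCycle A
    cycle with pigeonhole (ℕ.n<1+n n) (λ i → vertex (toℕ i))
    ... | i , j , i<j , same = vertex (toℕ j) , subst (λ z → Walk A z (vertex (toℕ j))) same (walk i<j)

  cycle-from-successors : ∀ {x} → P x → HasCycle A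
  cycle-from-successors px = Orbit.cycle px

module WithoutSink {n} (A : Fin (suc n) → Fin (suc n) → Bool) (s : Fin (suc n))
                   (sink : ∀ y → A s y ≡ false) where

  A∖s : Fin n → Fin n → Bool
  A∖s x y = A (punchIn s x) (punchIn s y)

  private
    source≢sink : ∀ {u v} → Walk A u v → s ≢ u
    source≢sink (arc p) refl = contradiction (trans (sym p) (sink _)) λ ()
    source≢sink (p ∷ _) refl = contradiction (trans (sym p) (sink _)) λ ()

    unpunch : ∀ {x y} (x≢ : s ≢ x) (y≢ : s ≢ y) → A x y ≡ true → A∖s (punchOut x≢) (punchOut y≢) ≡ true
    unpunch x≢ y≢ = subst₂ (λ a b → A a b ≡ true) (sym (punchIn-punchOut x≢)) (sym (punchIn-punchOut y≢))

    down : ∀ {u v} (w : Walk A u v) (v≢ : s ≢ v) → Walk A∖s (punchOut (source≢sink w)) (punchOut v≢)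
    down (arc p) v≢ = arc (unpunch _ v≢ p)
    down (p ∷ w) v≢ = unpunch _ (source≢sink w) p ∷ down w v≢

  cycle-avoids-sink : HasCycle A → HasCycle A∖s
  cycle-avoids-sink (u , w) = punchOut (source≢sink w) , down w (source≢sink w)

  cycle-unpunch : HasCycle A∖s → HasCycle A
  cycle-unpunch (u , w) = punchIn s u , mapʷ (punchIn s) (λ p → p) w

hasCycle? : ∀ {n} (A : Fin n → Fin n → Bool) → Dec (HasCycle A)
hasCycle? {zero} A = no λ ()
hasCycle? {suc n} A with any? (λ s → all? (λ y → A s y ≟ᵇ false))
... | yes (s , sink) = map′ cycle-unpunch cycle-avoids-sink (hasCycle? A∖s)
  where open WithoutSink A s sink
... | no noSink = yes (cycle-from-successors (λ _ → ⊤) next {zero} tt)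
  where
  next : ∀ {x} → ⊤ → Σ (Fin (suc n)) λ y → ⊤ × A x y ≡ true
  next {x} _ with any? (λ y → A x y ≟ᵇ true)
  ... | yes (y , p) = y , tt , p
  ... | no none = contradiction (x , λ y → ¬-not (λ p → none (y , p))) noSink

dependent? : ∀ {n} {G : Graph n} (D : Orientation G) u v → Dec (Dependent D u v)
dependent? D u v = (Arc D u v ≟ᵇ true) ×-dec hasCycle? _

dependentArcs : ∀ {n} {G : Graph n} → Orientation G → List (Fin n × Fin n)
dependentArcs {n} D = filter (uncurry (dependent? D)) (cartesianProduct (allFin n) (allFin n))

dependentArcs-count : ∀ {n} {G : Graph n} (D : Orientation G) → HasDepCount D (length (dependentArcs D))
dependentArcs-count {n} D =
  dependentArcs D ,
  Unique.filter⁺ _ (Unique.cartesianProduct⁺ (Unique.allFin⁺ n) (Unique.allFin⁺ n)) ,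
  refl ,
  λ u v → mk⇔ (λ m → proj₂ (∈-filter⁻ P? {xs = cartesianProduct (allFin n) (allFin n)} m))
              (∈-filter⁺ P? (∈-cartesianProduct⁺ (∈-allFin u) (∈-allFin v)))
  where P? = uncurry (dependent? D)

module _ {a} {X : Set a} (_≟_ : DecidableEquality X) where

  length-filter-≢ : ∀ {x xs} → Unique xs → x ∈ xs → suc (length (filter (λ y → ¬? (y ≟ x)) xs)) ≡ length xs
  length-filter-≢ {x} {y ∷ xs} (y∉xs ∷ u) x∈ with y ≟ x
  ... | yes refl = cong suc (cong length (filter-all (λ z → ¬? (z ≟ x)) (All.map (λ ne e → ne (sym e)) y∉xs)))
  length-filter-≢ {x} {y ∷ xs} (y∉xs ∷ u) (here refl) | no y≢x = contradiction refl y≢x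
  length-filter-≢ {x} {y ∷ xs} (y∉xs ∷ u) (there x∈) | no y≢x = cong suc (length-filter-≢ u x∈)

  Unique-⊆⇒length-≤ : ∀ {xs ys} → Unique xs → xs ⊆ ys → length xs ≤ length ys
  Unique-⊆⇒length-≤ {[]} _ _ = z≤n
  Unique-⊆⇒length-≤ {x ∷ xs} {ys} (x∉xs ∷ u) sub =
    ℕ.≤-trans (s≤s (Unique-⊆⇒length-≤ u sub′)) (length-remove (sub (here refl)))
    where
    remove : List X → List X
    remove = filter (λ y → ¬? (x ≟ y))

    sub′ : xs ⊆ remove ys
    sub′ z∈ = ∈-filter⁺ (λ y → ¬? (x ≟ y)) (sub (there z∈)) (All.lookup x∉xs z∈)

    length-remove : ∀ {zs} → x ∈ zs → suc (length (remove zs)) ≤ length zs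
    length-remove {z ∷ zs} (here refl) with x ≟ x
    ... | yes _ = s≤s (length-filter _ zs)
    ... | no x≢x = contradiction refl x≢x
    length-remove {z ∷ zs} (there x∈) with x ≟ z
    ... | yes _ = s≤s (ℕ.≤-trans (ℕ.n≤1+n _) (length-remove x∈))
    ... | no _ = s≤s (length-remove x∈)

members : ∀ {n} → Subset n → List (Fin n)
members [] = []
members (true ∷ p) = zero ∷ map suc (members p)
members (false ∷ p) = map suc (members p)

length-members : ∀ {n} (p : Subset n) → length (members p) ≡ ∣ p ∣
length-members [] = refl
length-members (true ∷ p) = cong suc (trans (length-map suc (members p)) (length-members p))
length-members (false ∷ p) = trans (length-map suc (members p)) (length-members p)

∈-members⁻ : ∀ {n} (p : Subset n) {x} → x ∈ members p → lookup p x ≡ true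
∈-members⁻ (true ∷ p) (here refl) = refl
∈-members⁻ (true ∷ p) (there x∈) with ∈-map⁻ suc x∈
... | _ , x∈′ , refl = ∈-members⁻ p x∈′
∈-members⁻ (false ∷ p) x∈ with ∈-map⁻ suc x∈
... | _ , x∈′ , refl = ∈-members⁻ p x∈′

∈-members⁺ : ∀ {n} (p : Subset n) x → lookup p x ≡ true → x ∈ members p
∈-members⁺ (true ∷ p) zero _ = here refl
∈-members⁺ (true ∷ p) (suc x) x∈p = there (∈-map⁺ suc (∈-members⁺ p x x∈p))
∈-members⁺ (false ∷ p) (suc x) x∈p = ∈-map⁺ suc (∈-members⁺ p x x∈p)

members-unique : ∀ {n} (p : Subset n) → Unique (members p)
members-unique [] = []
members-unique (true ∷ p) = All.tabulate zero∉ ∷ Unique.map⁺ suc-injective (members-unique p)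
  where
  zero∉ : ∀ {z} → z ∈ map suc (members p) → zero ≢ z
  zero∉ z∈ refl with ∈-map⁻ suc z∈
  ... | _ , _ , ()
members-unique (false ∷ p) = Unique.map⁺ suc-injective (members-unique p)

1≤∣p∣⇒member : ∀ {n} (p : Subset n) → 1 ≤ ∣ p ∣ → Σ (Fin n) λ x → lookup p x ≡ true
1≤∣p∣⇒member (true ∷ p) _ = zero , refl
1≤∣p∣⇒member (false ∷ p) 1≤∣p∣ = let (x , x∈p) = 1≤∣p∣⇒member p 1≤∣p∣ in suc x , x∈p

dropZero : ∀ {n} → (Fin (suc n) → Fin (suc n) → Bool) → Fin n → Fin n → Bool
dropZero R x y = R (suc x) (suc y)

module _ {n} (R : Fin (suc n) → Fin (suc n) → Bool) where

  ThroughZero : Set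
  ThroughZero = ∃₂ λ x y → R zero (suc x) ≡ true × R (suc y) zero ≡ true × Star (Arcs (dropZero R)) x y

  private
    firstReturn : ∀ {x} → Walk R (suc x) zero → Σ (Fin n) λ y → Star (Arcs (dropZero R)) x y × R (suc y) zero ≡ true
    firstReturn (arc p) = _ , ε , p
    firstReturn (_∷_ {w = zero} p _) = _ , ε , p
    firstReturn (_∷_ {w = suc _} p w) with firstReturn w
    ... | y , s , q = y , p ◅ s , q

    closedAtZero : R zero zero ≡ false → Walk R zero zero → ThroughZero
    closedAtZero noLoop (arc p) = contradiction (trans (sym p) noLoop) λ ()
    closedAtZero noLoop (_∷_ {w = zero} p _) = contradiction (trans (sym p) noLoop) λ ()
    closedAtZero noLoop (_∷_ {w = suc x} p w) with firstReturn w
    ... | y , s , q = x , y , p , q , s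

    avoidZero : ∀ {x y} → Walk R (suc x) (suc y) → Walk (dropZero R) x y ⊎ (Walk R (suc x) zero × Walk R zero (suc y))
    avoidZero (arc p) = inj₁ (arc p)
    avoidZero (_∷_ {w = zero} p w) = inj₂ (arc p , w)
    avoidZero (_∷_ {w = suc _} p w) with avoidZero w
    ... | inj₁ w↓ = inj₁ (p ∷ w↓)
    ... | inj₂ (to , from) = inj₂ (p ∷ to , from)

  cycle-avoids-or-through-zero : R zero zero ≡ false → HasCycle R → HasCycle (dropZero R) ⊎ ThroughZero
  cycle-avoids-or-through-zero noLoop (zero , w) = inj₂ (closedAtZero noLoop w)
  cycle-avoids-or-through-zero noLoop (suc u , w) with avoidZero w
  ... | inj₁ w↓ = inj₁ (u , w↓)
  ... | inj₂ (to , from) = inj₂ (closedAtZero noLoop (from ++ʷ to))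

  cycle-avoids-zero : (∀ x → R x zero ≡ false) → HasCycle R → HasCycle (dropZero R)
  cycle-avoids-zero noIn c with cycle-avoids-or-through-zero (noIn zero) c
  ... | inj₁ c↓ = c↓
  ... | inj₂ (_ , y , _ , q , _) = contradiction (trans (sym q) (noIn (suc y))) λ ()

module _ {n} {G : Graph n} (D : Orientation G) where

  arc⇒≢ : ∀ {u v} → Arc D u v ≡ true → u ≢ v
  arc⇒≢ {u} p refl = contradiction (trans (sym (onEdges D u u p)) (irrefl G u)) λ ()

  -- Reversing u → w closes the cycle w → u → t → w.
  triangle⇒dependent : ∀ {u t w} → Arc D u t ≡ true → Arc D t w ≡ true → Arc D u w ≡ true → Dependent D u w
  triangle⇒dependent {u} {t} {w} ut tw uw =
    uw , u , keep ut (on₁ u≢w) (on₂ t≢w) ∷ (keep tw (on₁ t≢w) (on₁ t≢u) ∷ arc (reverseArc-new (Arc D) u w))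
    where
    u≢w = arc⇒≢ uw
    t≢w = arc⇒≢ tw
    t≢u = λ e → arc⇒≢ ut (sym e)
    on₁ : ∀ {a b c d : Fin n} → a ≢ c → (a , b) ≢ (c , d)
    on₁ ne e = ne (cong proj₁ e)
    on₂ : ∀ {a b c d : Fin n} → b ≢ d → (a , b) ≢ (c , d)
    on₂ ne e = ne (cong proj₂ e)
    keep : ∀ {x y} → Arc D x y ≡ true → (x , y) ≢ (w , u) → (x , y) ≢ (u , w) → reverseArc (Arc D) u w x y ≡ true
    keep p ne₁ ne₂ = trans (reverseArc-other (Arc D) u w ne₁ ne₂) p

module _ {n} {A : Fin n → Fin n → Bool} (acyclic : ¬ HasCycle A) {P : Fin n → Set} (P? : Decidable P) where

  acyclic⇒source : ∀ {x} → P x → Σ (Fin n) λ w → P w × (∀ c → P c → A c w ≡ false)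
  acyclic⇒source px with any? (λ w → P? w ×-dec all? (λ c → P? c →-dec (A c w ≟ᵇ false)))
  ... | yes source = source
  ... | no noSource = contradiction (reverse (cycle-from-successors P predecessor px)) acyclic
    where
    reverse : HasCycle (flip A) → HasCycle A
    reverse (u , w) = u , reverseʷ w
    predecessor : ∀ {w} → P w → Σ (Fin n) λ c → P c × A c w ≡ true
    predecessor {w} pw with any? (λ c → P? c ×-dec (A c w ≟ᵇ true))
    ... | yes found = found
    ... | no none = contradiction (w , pw , λ c pc → ¬-not (λ a → none (c , pc , a))) noSource

clique-source : ∀ {n} {G : Graph n} {Q : Subset n} (D : Orientation G) → Acyclic D → IsClique G Q →
                ∀ {x} → lookup Q x ≡ true →
                Σ (Fin n) λ s → lookup Q s ≡ true × (∀ c → lookup Q c ≡ true → c ≢ s → Arc D s c ≡ true)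
clique-source {Q = Q} D acyclic clique x∈Q with acyclic⇒source acyclic (λ w → lookup Q w ≟ᵇ true) x∈Q
... | s , s∈Q , noIn = s , s∈Q , out
  where
  out : ∀ c → lookup Q c ≡ true → c ≢ s → Arc D s c ≡ true
  out c c∈Q c≢s with covers D s c (clique s c (lookup⇒[]= s Q s∈Q) (lookup⇒[]= c Q c∈Q) (λ e → c≢s (sym e)))
  ... | inj₁ sc = sc
  ... | inj₂ cs = contradiction (trans (sym cs) (noIn c c∈Q)) λ ()

liftArc : ∀ {n} → Fin n × Fin n → Fin (suc n) × Fin (suc n)
liftArc = Product.map suc suc

liftArc-injective : ∀ {n} {a b : Fin n × Fin n} → liftArc a ≡ liftArc b → a ≡ b
liftArc-injective {a = _ , _} {_ , _} refl = refl

module Extension {n} {G : Graph n} (Q : Subset n) (D : Orientation G) where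

  extendArc : Fin (suc n) → Fin (suc n) → Bool
  extendArc zero zero = false
  extendArc zero (suc j) = lookup Q j
  extendArc (suc i) zero = false
  extendArc (suc i) (suc j) = Arc D i j

  private
    onEdges′ : ∀ i j → extendArc i j ≡ true → extAdj G Q i j ≡ true
    onEdges′ zero (suc j) p = p
    onEdges′ (suc i) (suc j) p = onEdges D i j p

    covers′ : ∀ i j → extAdj G Q i j ≡ true → extendArc i j ≡ true ⊎ extendArc j i ≡ true
    covers′ zero (suc j) p = inj₁ p
    covers′ (suc i) zero p = inj₂ p
    covers′ (suc i) (suc j) p = covers D i j p

    oneWay′ : ∀ i j → extendArc i j ≡ true → extendArc j i ≡ false
    oneWay′ zero (suc j) p = refl
    oneWay′ (suc i) (suc j) p = oneWay D i j p

  extend : Orientation (addVertex G Q)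
  extend = record { Arc = extendArc ; onEdges = onEdges′ ; covers = covers′ ; oneWay = oneWay′ }

  extendArc-no-in : ∀ x → extendArc x zero ≡ false
  extendArc-no-in zero = refl
  extendArc-no-in (suc x) = refl

  extend-acyclic : Acyclic D → Acyclic extend
  extend-acyclic acyclic c = acyclic (cycle-avoids-zero extendArc extendArc-no-in c)

  dependent-lift⇔ : ∀ a b → Dependent extend (suc a) (suc b) ⇔ Dependent D a b
  dependent-lift⇔ a b = mk⇔ (Product.map₂ (cycle-avoids-zero _ no-in)) (Product.map₂ lift)
    where
    no-in : ∀ x → reverseArc extendArc (suc a) (suc b) x zero ≡ false
    no-in x = trans (reverseArc-other extendArc (suc a) (suc b) {x} (λ ()) (λ ())) (extendArc-no-in x)
    lift : HasCycle (reverseArc (Arc D) a b) → HasCycle (reverseArc extendArc (suc a) (suc b))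
    lift (u , w) = suc u , mapʷ suc (λ p → p) w

  module _ (acyclic : Acyclic D) {s} (s∈Q : lookup Q s ≡ true)
           (out : ∀ c → lookup Q c ≡ true → c ≢ s → Arc D s c ≡ true) where

    spoke-dependent : ∀ {w} → lookup Q w ≡ true → w ≢ s → Dependent extend zero (suc w)
    spoke-dependent w∈Q w≢s = triangle⇒dependent extend {t = suc s} s∈Q (out _ w∈Q w≢s) w∈Q

    private
      R = reverseArc extendArc zero (suc s)

      R↓⇒D : ∀ {x y} → R (suc x) (suc y) ≡ true → Arc D x y ≡ true
      R↓⇒D {x} {y} = trans (sym (reverseArc-other extendArc zero (suc s) {suc x} {suc y} (λ ()) (λ ())))

      enter : ∀ {x} → R zero (suc x) ≡ true → lookup Q x ≡ true × x ≢ s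
      enter {x} p with x Fin.≟ s
      ... | yes refl = contradiction p λ ()
      ... | no x≢s = p , x≢s

      leave : ∀ {y} → R (suc y) zero ≡ true → y ≡ s
      leave {y} p with y Fin.≟ s
      ... | yes y≡s = y≡s
      ... | no _ = contradiction p λ ()

    source-spoke-independent : ¬ Dependent extend zero (suc s)
    source-spoke-independent (_ , c) with cycle-avoids-or-through-zero R refl c
    ... | inj₁ (u , w) = acyclic (u , mapʷ (λ x → x) R↓⇒D w)
    ... | inj₂ (x , y , zx , y0 , path) with enter zx | leave {y} y0
    ...   | x∈Q , x≢s | refl = acyclic (s , out x x∈Q x≢s ◅ʷ Star.map R↓⇒D path)

    private
      others : List (Fin n)
      others = filter (λ w → ¬? (w Fin.≟ s)) (members Q)

      toSpoke : Fin n → Fin (suc n) × Fin (suc n)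
      toSpoke w = zero , suc w

      toSpoke-injective : ∀ {x y} → toSpoke x ≡ toSpoke y → x ≡ y
      toSpoke-injective refl = refl

      length-others : suc (length others) ≡ ∣ Q ∣
      length-others = trans (length-filter-≢ Fin._≟_ (members-unique Q) (∈-members⁺ Q s s∈Q)) (length-members Q)

    extend-count : ∀ {d} → HasDepCount D d → HasDepCount extend (d + ∣ Q ∣ ∸ 1)
    extend-count (L , unique , refl , L⇔) = L′ , unique′ , length′ , λ u v → mk⇔ (sound u v) (complete u v)
      where
      L′ = map liftArc L ++ map toSpoke others

      disjoint : ∀ {a} → ¬ (a ∈ map liftArc L × a ∈ map toSpoke others)
      disjoint (m₁ , m₂) with ∈-map⁻ liftArc m₁ | ∈-map⁻ toSpoke m₂
      ... | _ , _ , refl | _ , _ , ()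

      unique′ : Unique L′
      unique′ = Unique.++⁺ (Unique.map⁺ liftArc-injective unique)
                           (Unique.map⁺ toSpoke-injective (Unique.filter⁺ _ (members-unique Q))) disjoint

      length′ : length L′ ≡ length L + ∣ Q ∣ ∸ 1
      length′ = begin
        length L′                                              ≡⟨ length-++ (map liftArc L) ⟩
        length (map liftArc L) + length (map toSpoke others)   ≡⟨ cong₂ _+_ (length-map liftArc L) (length-map toSpoke others) ⟩
        length L + length others                               ≡⟨ cong (_∸ 1) (ℕ.+-suc (length L) (length others)) ⟨
        length L + suc (length others) ∸ 1                     ≡⟨ cong (λ k → length L + k ∸ 1) length-others ⟩
        length L + ∣ Q ∣ ∸ 1                                   ∎
        where open ≡-Reasoning

      sound : ∀ u v → (u , v) ∈ L′ → Dependent extend u v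
      sound u v m with ∈-++⁻ (map liftArc L) m
      ... | inj₁ m₁ with ∈-map⁻ liftArc m₁
      ...   | (a , b) , ab∈L , refl = from (dependent-lift⇔ a b) (to (L⇔ a b) ab∈L)
      sound u v m | inj₂ m₂ with ∈-map⁻ toSpoke m₂
      ...   | w , w∈ , refl with ∈-filter⁻ (λ w → ¬? (w Fin.≟ s)) {xs = members Q} w∈
      ...     | w∈Q , w≢s = spoke-dependent (∈-members⁻ Q w∈Q) w≢s

      complete : ∀ u v → Dependent extend u v → (u , v) ∈ L′
      complete zero zero (() , _)
      complete zero (suc w) dep with w Fin.≟ s
      ... | yes refl = contradiction dep source-spoke-independent
      ... | no w≢s = ∈-++⁺ʳ (map liftArc L) (∈-map⁺ toSpoke (∈-filter⁺ (λ w → ¬? (w Fin.≟ s)) (∈-members⁺ Q w (proj₁ dep)) w≢s))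
      complete (suc a) zero (() , _)
      complete (suc a) (suc b) dep = ∈-++⁺ˡ (∈-map⁺ liftArc (from (L⇔ a b) (to (dependent-lift⇔ a b) dep)))

two-of-three-equal : (x y z : Bool) → x ≡ y ⊎ x ≡ z ⊎ y ≡ z
two-of-three-equal false false _ = inj₁ refl
two-of-three-equal true true _ = inj₁ refl
two-of-three-equal false true false = inj₂ (inj₁ refl)
two-of-three-equal false true true = inj₂ (inj₂ refl)
two-of-three-equal true false false = inj₂ (inj₂ refl)
two-of-three-equal true false true = inj₂ (inj₁ refl)

pairDec : ∀ {n} → DecidableEquality (Fin n × Fin n)
pairDec = ≡-dec Fin._≟_ Fin._≟_

module Restriction {n} {G : Graph n} {Q : Subset n} (D′ : Orientation (addVertex G Q)) where

  restrict : Orientation G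
  restrict = record
    { Arc = dropZero (Arc D′)
    ; onEdges = λ i j → onEdges D′ (suc i) (suc j)
    ; covers = λ i j → covers D′ (suc i) (suc j)
    ; oneWay = λ i j → oneWay D′ (suc i) (suc j)
    }

  restrict-acyclic : Acyclic D′ → Acyclic restrict
  restrict-acyclic acyclic (u , w) = acyclic (suc u , mapʷ suc (λ p → p) w)

  dependent-lift : ∀ {a b} → Dependent restrict a b → Dependent D′ (suc a) (suc b)
  dependent-lift = Product.map₂ λ (u , w) → suc u , mapʷ suc (λ p → p) w

  spoke : Fin n → Fin (suc n) × Fin (suc n)
  spoke w = if Arc D′ zero (suc w) then (zero , suc w) else (suc w , zero)

  spoke-injective : ∀ {x y} → spoke x ≡ spoke y → x ≡ y
  spoke-injective {x} {y} e with Arc D′ zero (suc x) | Arc D′ zero (suc y)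
  ... | true | true = suc-injective (cong proj₂ e)
  ... | false | false = suc-injective (cong proj₁ e)
  ... | true | false = contradiction (cong proj₁ e) λ ()
  ... | false | true = contradiction (cong proj₁ e) λ ()

  SpokeDependent : Fin n → Set
  SpokeDependent w = uncurry (Dependent D′) (spoke w)

  private
    spoke-out : ∀ {w} → Arc D′ zero (suc w) ≡ true → spoke w ≡ (zero , suc w)
    spoke-out e rewrite e = refl

    into-zero : ∀ {w} → lookup Q w ≡ true → Arc D′ zero (suc w) ≡ false → Arc D′ (suc w) zero ≡ true
    into-zero w∈Q e with covers D′ zero (suc _) w∈Q
    ... | inj₁ p = contradiction (trans (sym p) e) λ ()
    ... | inj₂ p = p

    -- Abstracting Arc D′ zero (suc x) makes spoke x compute, while spoke y must be rewritten.
    ordered⇒spoke-dependent : ∀ {x y} → Arc D′ (suc x) (suc y) ≡ true → lookup Q x ≡ true → lookup Q y ≡ true →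
                              Arc D′ zero (suc x) ≡ Arc D′ zero (suc y) → SpokeDependent x ⊎ SpokeDependent y
    ordered⇒spoke-dependent {x} {y} xy x∈Q y∈Q same with Arc D′ zero (suc x) in ex
    ... | true = inj₂ (subst (uncurry (Dependent D′)) (sym (spoke-out (sym same)))
                        (triangle⇒dependent D′ ex xy (sym same)))
    ... | false = inj₁ (triangle⇒dependent D′ xy (into-zero y∈Q (sym same)) (into-zero x∈Q ex))

  same-direction⇒spoke-dependent : IsClique G Q → ∀ {x y} → x ≢ y → lookup Q x ≡ true → lookup Q y ≡ true →
                                   Arc D′ zero (suc x) ≡ Arc D′ zero (suc y) → SpokeDependent x ⊎ SpokeDependent y
  same-direction⇒spoke-dependent clique {x} {y} x≢y x∈Q y∈Q same
    with covers D′ (suc x) (suc y) (clique x y (lookup⇒[]= x Q x∈Q) (lookup⇒[]= y Q y∈Q) x≢y)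
  ... | inj₁ xy = ordered⇒spoke-dependent xy x∈Q y∈Q same
  ... | inj₂ yx = Sum.swap (ordered⇒spoke-dependent yx y∈Q x∈Q (sym same))

  at-most-two-independent-spokes : IsClique G Q → ∀ {E} → Unique E →
                                   All (λ w → lookup Q w ≡ true × ¬ SpokeDependent w) E → length E ≤ 2
  at-most-two-independent-spokes clique {[]} _ _ = z≤n
  at-most-two-independent-spokes clique {_ ∷ []} _ _ = s≤s z≤n
  at-most-two-independent-spokes clique {_ ∷ _ ∷ []} _ _ = s≤s (s≤s z≤n)
  at-most-two-independent-spokes clique {a ∷ b ∷ c ∷ _} ((a≢b ∷ a≢c ∷ _) ∷ (b≢c ∷ _) ∷ _)
                                                        ((a∈Q , ¬a) ∷ (b∈Q , ¬b) ∷ (c∈Q , ¬c) ∷ _)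
    with two-of-three-equal (Arc D′ zero (suc a)) (Arc D′ zero (suc b)) (Arc D′ zero (suc c))
  ... | inj₁ ab = ⊥-elim $ [ ¬a , ¬b ]′ (same-direction⇒spoke-dependent clique a≢b a∈Q b∈Q ab)
  ... | inj₂ (inj₁ ac) = ⊥-elim $ [ ¬a , ¬c ]′ (same-direction⇒spoke-dependent clique a≢c a∈Q c∈Q ac)
  ... | inj₂ (inj₂ bc) = ⊥-elim $ [ ¬b , ¬c ]′ (same-direction⇒spoke-dependent clique b≢c b∈Q c∈Q bc)

  restrict-count-bound : IsClique G Q → ∀ {m′ k} → HasDepCount D′ m′ → HasDepCount restrict k → k + ∣ Q ∣ ≤ m′ + 2
  restrict-count-bound clique (L′ , _ , refl , L′⇔) (K , uniqueK , refl , K⇔) = begin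
    length K + ∣ Q ∣                         ≡⟨ length-xs ⟨
    length xs                                ≤⟨ Unique-⊆⇒length-≤ pairDec unique-xs xs⊆ ⟩
    length (L′ ++ map spoke E)               ≡⟨ length-++ L′ ⟩
    length L′ + length (map spoke E)         ≡⟨ cong (length L′ +_) (length-map spoke E) ⟩
    length L′ + length E                     ≤⟨ ℕ.+-monoʳ-≤ (length L′) (at-most-two-independent-spokes clique unique-E independent-E) ⟩
    length L′ + 2                            ∎
    where
    open ℕ.≤-Reasoning
    open DecMembership pairDec using (_∈?_)

    xs = map liftArc K ++ map spoke (members Q)
    independent? = λ w → ¬? (spoke w ∈? L′)
    E = filter independent? (members Q)

    length-xs : length xs ≡ length K + ∣ Q ∣
    length-xs = trans (length-++ (map liftArc K))
                      (cong₂ _+_ (length-map liftArc K) (trans (length-map spoke (members Q)) (length-members Q)))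

    disjoint : ∀ {a} → ¬ (a ∈ map liftArc K × a ∈ map spoke (members Q))
    disjoint (m₁ , m₂) with ∈-map⁻ liftArc m₁ | ∈-map⁻ spoke m₂
    ... | _ , _ , refl | w , _ , e with Arc D′ zero (suc w)
    ...   | true = contradiction (cong proj₁ e) λ ()
    ...   | false = contradiction (cong proj₂ e) λ ()

    unique-xs : Unique xs
    unique-xs = Unique.++⁺ (Unique.map⁺ liftArc-injective uniqueK) (Unique.map⁺ spoke-injective (members-unique Q)) disjoint

    xs⊆ : xs ⊆ L′ ++ map spoke E
    xs⊆ m with ∈-++⁻ (map liftArc K) m
    ... | inj₁ m₁ with ∈-map⁻ liftArc m₁
    ...   | (a , b) , ab∈K , refl = ∈-++⁺ˡ (from (L′⇔ (suc a) (suc b)) (dependent-lift (to (K⇔ a b) ab∈K)))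
    xs⊆ m | inj₂ m₂ with ∈-map⁻ spoke m₂
    ...   | w , w∈Q , refl with spoke w ∈? L′
    ...     | yes w∈L′ = ∈-++⁺ˡ w∈L′
    ...     | no w∉L′ = ∈-++⁺ʳ L′ (∈-map⁺ spoke (∈-filter⁺ independent? w∈Q w∉L′))

    unique-E : Unique E
    unique-E = Unique.filter⁺ independent? (members-unique Q)

    independent-E : All (λ w → lookup Q w ≡ true × ¬ SpokeDependent w) E
    independent-E = All.tabulate λ w∈E →
      let (w∈Q , w∉L′) = ∈-filter⁻ independent? {xs = members Q} w∈E
      in ∈-members⁻ Q w∈Q , λ dep → w∉L′ (from (L′⇔ _ _) dep)

squeeze : ∀ m′ N → 1 ≤ N → m′ ≤ N ∸ 1 → N ≤ m′ + 2 → (m′ + 2 ≡ N) ⊎ (m′ + 1 ≡ N)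
squeeze m′ (suc N) _ m′≤N N≤m′+2 rewrite ℕ.+-comm m′ 2 | ℕ.+-comm m′ 1
  with ℕ.m≤n⇒m<n∨m≡n (s≤s⁻¹ N≤m′+2)
... | inj₁ N<1+m′ = inj₂ (cong suc (ℕ.≤-antisym m′≤N (s≤s⁻¹ N<1+m′)))
... | inj₂ N≡1+m′ = inj₁ (cong suc (sym N≡1+m′))

lemma2 : ∀ {n : ℕ} (G : Graph n) (Q : Subset n) (q : ℕ) →
         IsClique G Q → ∣ Q ∣ ≡ q → 1 ≤ q →
         ((D : Orientation G) (d : ℕ) → Acyclic D → HasDepCount D d →
            Σ (Orientation (addVertex G Q)) λ D' → Acyclic D' × HasDepCount D' (d + q ∸ 1))
         ×
         (∀ m m' → IsDmin G m → IsDmin (addVertex G Q) m' →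
            (m' + 2 ≡ m + q) ⊎ (m' + 1 ≡ m + q))
lemma2 G Q _ clique refl 1≤q = extension , bounds
  where
  open Extension Q
  open Restriction

  extension : (D : Orientation G) (d : ℕ) → Acyclic D → HasDepCount D d →
              Σ (Orientation (addVertex G Q)) λ D′ → Acyclic D′ × HasDepCount D′ (d + ∣ Q ∣ ∸ 1)
  extension D d acyclic count =
    let (x , x∈Q) = 1≤∣p∣⇒member Q 1≤q
        (s , s∈Q , out) = clique-source D acyclic clique x∈Q
    in extend D , extend-acyclic D acyclic , extend-count D acyclic s∈Q out count

  bounds : ∀ m m′ → IsDmin G m → IsDmin (addVertex G Q) m′ → (m′ + 2 ≡ m + ∣ Q ∣) ⊎ (m′ + 1 ≡ m + ∣ Q ∣)
  bounds m m′ ((D , acyclic , count) , minimal) ((D′ , acyclic′ , count′) , minimal′) =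
    squeeze m′ (m + ∣ Q ∣) (ℕ.≤-trans 1≤q (ℕ.m≤n+m _ m)) upper lower
    where
    upper : m′ ≤ m + ∣ Q ∣ ∸ 1
    upper = let (D₁ , acyclic₁ , count₁) = extension D m acyclic count in minimal′ D₁ _ acyclic₁ count₁

    lower : m + ∣ Q ∣ ≤ m′ + 2
    lower = ℕ.≤-trans (ℕ.+-monoˡ-≤ ∣ Q ∣ (minimal (restrict D′) _ (restrict-acyclic D′ acyclic′) restrictCount))
                      (restrict-count-bound D′ clique count′ restrictCount)
      where restrictCount = dependentArcs-count (restrict D′)
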